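{- If $N\ge R^{(4)}(5,5,5,5,5,5,6,6)$, then there does not exist an $I(N,4)$ admissible set.
   Context: $R^{(k)}(n_1,\dots,n_c)$ denotes the hypergraph Ramsey number: the smallest $N$ such that for every colouring of the $k$-element subsets of $[N]=\{1,\dots,N\}$ with colours $1,\dots,c$ there is some $i$ and a subset of $[N]$ of size $n_i$ all of whose $k$-element subsets have colour $i$. For $v\in\{0,1,2\}^m$, $\mathrm{Supp}\, v=\{i: v_i\neq0\}$; $V_S$ is the set of vectors in $\{0,1,2\}^m$ with support exactly $S$. A subset of $\{0,1,2\}^m$ is $I(m,w)$ if it contains exactly one element of $V_S$ for each $S\subseteq[m]$ with $|S|=w$ and no other elements. Two vectors form a clash if the support of one is contained in that of the other; three vectors $v_1,v_2,v_3$ form a clash if there is no coordinate at which exactly one of them is non-zero and no coordinate at which their three values are pairwise distinct. A set is admissible if it contains no clash (of two distinct or three distinct elements). -}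

module Defs where

open import Data.Nat using (ℕ; _≤_)
open import Data.Fin using (Fin; zero; suc)
open import Data.Fin.Subset using (Subset; Side; _⊆_; ∣_∣; inside; outside)
open import Data.Sum using (_⊎_)
open import Data.Vec using (Vec; map; lookup)
open import Data.Product using (Σ; _×_; _,_; ∃)
open import Relation.Binary.PropositionalEquality using (_≡_; _≢_)
open import Relation.Nullary using (¬_)

Colouring : (k N c : ℕ) → Set
Colouring k N c = (s : Subset N) → ∣ s ∣ ≡ k → Fin c

Monochromatic : ∀ {k N c} → Colouring k N c → Fin c → ℕ → Subset N → Set
Monochromatic {k} {N} χ i n T =
  ∣ T ∣ ≡ n × ((s : Subset N) (hs : ∣ s ∣ ≡ k) → s ⊆ T → χ s hs ≡ i)

RamseyProperty : (k c : ℕ) → (Fin c → ℕ) → ℕ → Set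
RamseyProperty k c ns N =
  (χ : Colouring k N c) → Σ (Fin c) λ i → Σ (Subset N) λ T → Monochromatic χ i (ns i) T

IsRamseyNumber : (k c : ℕ) → (Fin c → ℕ) → ℕ → Set
IsRamseyNumber k c ns R =
  RamseyProperty k c ns R × ((M : ℕ) → RamseyProperty k c ns M → R ≤ M)

ns556 : Fin 8 → ℕ
ns556 zero = 5
ns556 (suc zero) = 5
ns556 (suc (suc zero)) = 5
ns556 (suc (suc (suc zero))) = 5
ns556 (suc (suc (suc (suc zero)))) = 5
ns556 (suc (suc (suc (suc (suc zero))))) = 5
ns556 (suc (suc (suc (suc (suc (suc zero)))))) = 6
ns556 (suc (suc (suc (suc (suc (suc (suc zero))))))) = 6

Vec3 : ℕ → Set
Vec3 m = Vec (Fin 3) m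

isNonZero : Fin 3 → Side
isNonZero zero = outside
isNonZero (suc _) = inside

Supp : ∀ {m} → Vec3 m → Subset m
Supp v = map isNonZero v

VecSet : ℕ → Set₁
VecSet m = Vec3 m → Set

IsI : (m w : ℕ) → VecSet m → Set
IsI m w A =
  ((v : Vec3 m) → A v → ∣ Supp v ∣ ≡ w)
  × ((S : Subset m) → ∣ S ∣ ≡ w → Σ (Vec3 m) λ v → A v × Supp v ≡ S)
  × ((u v : Vec3 m) → A u → A v → Supp u ≡ Supp v → u ≡ v)

Clash2 : ∀ {m} → Vec3 m → Vec3 m → Set
Clash2 u v = Supp u ⊆ Supp v ⊎ Supp v ⊆ Supp u

ExactlyOneNonZero : Fin 3 → Fin 3 → Fin 3 → Set
ExactlyOneNonZero a b c =
  (a ≢ zero × b ≡ zero × c ≡ zero)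
  ⊎ (a ≡ zero × b ≢ zero × c ≡ zero)
  ⊎ (a ≡ zero × b ≡ zero × c ≢ zero)

PairwiseDistinct : Fin 3 → Fin 3 → Fin 3 → Set
PairwiseDistinct a b c = a ≢ b × b ≢ c × a ≢ c

Clash3 : ∀ {m} → Vec3 m → Vec3 m → Vec3 m → Set
Clash3 {m} u v w =
  ¬ (Σ (Fin m) λ i → ExactlyOneNonZero (lookup u i) (lookup v i) (lookup w i))
  × ¬ (Σ (Fin m) λ i → PairwiseDistinct (lookup u i) (lookup v i) (lookup w i))

Admissible : ∀ {m} → VecSet m → Set
Admissible {m} A =
  ((u v : Vec3 m) → A u → A v → u ≢ v → ¬ Clash2 u v)
  × ((u v w : Vec3 m) → A u → A v → A w → u ≢ v → v ≢ w → u ≢ w → ¬ Clash3 u v w)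

{-# OPTIONS --safe #-}
-- Colour a 4-set S ⊆ [R] ⊆ [N] by the word over {1,2} formed by the nonzero entries of the
-- vector of A with support S. A binary word of length 4 either has two equal adjacent letters x
-- at positions j, j+1 (j = 0, 1, 2) or alternates x y x y; together with the letter x this gives
-- 8 colours. If T is a monochromatic 5-set of pair shape j, the vectors of A supported on T minus
-- its j-th, (j+1)-th and (j+2)-th element form a 3-clash: at every point of T either all three
-- are nonzero, and three values in {1,2} are never pairwise distinct, or exactly one of them
-- vanishes and the other two both equal x. For alternating words, a monochromatic 6-set
-- B₁ ∪ B₂ ∪ B₃ (consecutive pairs) does the same with the vectors supported on B₁ ∪ B₂, B₁ ∪ B₃
-- and B₂ ∪ B₃.
module Submission where

open import Defs
open import Data.Fin using (Fin; zero; suc; combine; remQuot; opposite)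
open import Data.Fin.Properties using (_≟_; remQuot-combine)
open import Data.Fin.Subset using (Subset; inside; outside; ∣_∣; _⊆_; ⊥; ∁; ⁅_⁆)
open import Data.Fin.Subset.Properties using (∣⊥∣≡0; out⊆; s⊆s)
open import Data.List using (List; []; _∷_; length)
import Data.Nat as ℕ
open import Data.Nat using (ℕ; _≤_; _+_)
open import Data.Nat.Properties using (m≤n⇒∃[o]m+o≡n; suc-injective)
open import Data.Product using (Σ; _×_; _,_; proj₁; proj₂; uncurry)
open import Data.Sum using (inj₁; inj₂)
open import Data.Unit using (⊤; tt)
open import Data.Vec using (Vec; []; _∷_; _++_; lookup)
open import Data.Vec.Properties using (∷-injectiveˡ; ∷-injectiveʳ)
open import Function using (_∘_)
open import Relation.Binary.PropositionalEquality
open import Relation.Nullary using (¬_; yes; no; contradiction)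

private
  variable
    n k d : ℕ

≢-≢⇒≡ : {a b c : Fin 2} → a ≢ b → b ≢ c → a ≡ c
≢-≢⇒≡ {zero}     {zero}                a≢b _   = contradiction refl a≢b
≢-≢⇒≡ {zero}     {suc zero} {zero}     _   _   = refl
≢-≢⇒≡ {zero}     {suc zero} {suc zero} _   b≢c = contradiction refl b≢c
≢-≢⇒≡ {suc zero} {zero}     {zero}     _   b≢c = contradiction refl b≢c
≢-≢⇒≡ {suc zero} {zero}     {suc zero} _   _   = refl
≢-≢⇒≡ {suc zero} {suc zero}            a≢b _   = contradiction refl a≢b

≢⇒≡opposite : {a b : Fin 2} → a ≢ b → b ≡ opposite a
≢⇒≡opposite {zero}     {zero}     a≢b = contradiction refl a≢b
≢⇒≡opposite {zero}     {suc zero} _   = refl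
≢⇒≡opposite {suc zero} {zero}     _   = refl
≢⇒≡opposite {suc zero} {suc zero} a≢b = contradiction refl a≢b

ClashColumn : Fin 3 → Fin 3 → Fin 3 → Set
ClashColumn a b c = ¬ ExactlyOneNonZero a b c × ¬ PairwiseDistinct a b c

clash-000 : ClashColumn zero zero zero
clash-000 =
  (λ { (inj₁ (a≢0 , _)) → a≢0 refl
     ; (inj₂ (inj₁ (_ , b≢0 , _))) → b≢0 refl
     ; (inj₂ (inj₂ (_ , _ , c≢0))) → c≢0 refl })
  , λ (a≢b , _) → a≢b refl

clash-0xx : ∀ x → ClashColumn zero (suc x) (suc x)
clash-0xx x =
  (λ { (inj₁ (0≢0 , _)) → 0≢0 refl ; (inj₂ (inj₁ (_ , _ , ()))) ; (inj₂ (inj₂ (_ , () , _))) })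
  , λ (_ , b≢c , _) → b≢c refl

clash-x0x : ∀ x → ClashColumn (suc x) zero (suc x)
clash-x0x x =
  (λ { (inj₁ (_ , _ , ())) ; (inj₂ (inj₁ (() , _))) ; (inj₂ (inj₂ (() , _))) })
  , λ (_ , _ , a≢c) → a≢c refl

clash-xx0 : ∀ x → ClashColumn (suc x) (suc x) zero
clash-xx0 x =
  (λ { (inj₁ (_ , () , _)) ; (inj₂ (inj₁ (() , _))) ; (inj₂ (inj₂ (() , _))) })
  , λ (a≢b , _) → a≢b refl

clash-nonzero : ∀ x y z → ClashColumn (suc x) (suc y) (suc z)
clash-nonzero x y z =
  (λ { (inj₁ (_ , () , _)) ; (inj₂ (inj₁ (() , _))) ; (inj₂ (inj₂ (() , _))) })
  , λ (a≢b , b≢c , a≢c) → a≢c (cong suc (≢-≢⇒≡ (a≢b ∘ cong suc) (b≢c ∘ cong suc)))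

ClashColumns : Vec3 n → Vec3 n → Vec3 n → Set
ClashColumns []      []      []      = ⊤
ClashColumns (a ∷ u) (b ∷ v) (c ∷ w) = ClashColumn a b c × ClashColumns u v w

lookup-clashColumns : {u v w : Vec3 n} → ClashColumns u v w →
                      (i : Fin n) → ClashColumn (lookup u i) (lookup v i) (lookup w i)
lookup-clashColumns {u = _ ∷ _} {_ ∷ _} {_ ∷ _} (col , _)  zero    = col
lookup-clashColumns {u = _ ∷ _} {_ ∷ _} {_ ∷ _} (_ , cols) (suc i) = lookup-clashColumns cols i

clashColumns⇒Clash3 : {u v w : Vec3 n} → ClashColumns u v w → Clash3 u v w
clashColumns⇒Clash3 cols =
  (λ (i , one)      → proj₁ (lookup-clashColumns cols i) one) ,
  (λ (i , distinct) → proj₂ (lookup-clashColumns cols i) distinct)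

word : Vec3 n → List (Fin 2)
word []          = []
word (zero  ∷ v) = word v
word (suc x ∷ v) = x ∷ word v

length-word : (v : Vec3 n) → length (word v) ≡ ∣ Supp v ∣
length-word []          = refl
length-word (zero  ∷ v) = length-word v
length-word (suc x ∷ v) = cong ℕ.suc (length-word v)

-- select T m keeps the j-th element of T iff j ∈ m. The clauses where T and m (or m and a word
-- in expand) do not have matching sizes are junk: the lemmas about them assume ∣ T ∣ ≡ k.
select : Subset n → Subset k → Subset n
select []            _       = []
select (outside ∷ T) m       = outside ∷ select T m
select (inside  ∷ T) []      = outside ∷ select T []
select (inside  ∷ T) (b ∷ m) = b ∷ select T m

select-⊆ : (T : Subset n) (m : Subset k) → select T m ⊆ T
select-⊆ []            _             ()
select-⊆ (outside ∷ T) m             = out⊆ (select-⊆ T m)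
select-⊆ (inside  ∷ T) []            = out⊆ (select-⊆ T [])
select-⊆ (inside  ∷ T) (outside ∷ m) = out⊆ (select-⊆ T m)
select-⊆ (inside  ∷ T) (inside  ∷ m) = s⊆s (select-⊆ T m)

∣select∣ : (T : Subset n) (m : Subset k) → ∣ T ∣ ≡ k → ∣ select T m ∣ ≡ ∣ m ∣
∣select∣ []            []            _ = refl
∣select∣ (outside ∷ T) m             h = ∣select∣ T m h
∣select∣ (inside  ∷ T) (outside ∷ m) h = ∣select∣ T m (suc-injective h)
∣select∣ (inside  ∷ T) (inside  ∷ m) h = cong ℕ.suc (∣select∣ T m (suc-injective h))

select-injective : (T : Subset n) → ∣ T ∣ ≡ k → {m m′ : Subset k} → select T m ≡ select T m′ → m ≡ m′
select-injective []            _ {[]}    {[]}      _  = refl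
select-injective (outside ∷ T) h                   eq = select-injective T h (∷-injectiveʳ eq)
select-injective (inside  ∷ T) h {_ ∷ _} {_ ∷ _}   eq =
  cong₂ _∷_ (∷-injectiveˡ eq) (select-injective T (suc-injective h) (∷-injectiveʳ eq))

∣p++⊥∣ : (p : Subset n) → ∣ p ++ ⊥ {d} ∣ ≡ ∣ p ∣
∣p++⊥∣ {d = d} []  = ∣⊥∣≡0 d
∣p++⊥∣ (outside ∷ p) = ∣p++⊥∣ p
∣p++⊥∣ (inside  ∷ p) = cong ℕ.suc (∣p++⊥∣ p)

select-⊥ : (m : Subset k) → select (⊥ {d}) m ≡ ⊥
select-⊥ {d = ℕ.zero}  m = refl
select-⊥ {d = ℕ.suc d} m = cong (outside ∷_) (select-⊥ m)

select-++-⊥ : (T : Subset n) (m : Subset k) → select (T ++ ⊥ {d}) m ≡ select T m ++ ⊥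
select-++-⊥ []            m       = select-⊥ m
select-++-⊥ (outside ∷ T) m       = cong (outside ∷_) (select-++-⊥ T m)
select-++-⊥ (inside  ∷ T) []      = cong (outside ∷_) (select-++-⊥ T [])
select-++-⊥ (inside  ∷ T) (b ∷ m) = cong (b ∷_) (select-++-⊥ T m)

spread : Subset n → Vec (Fin 3) k → Vec3 n
spread []            _       = []
spread (outside ∷ T) w       = zero ∷ spread T w
spread (inside  ∷ T) []      = zero ∷ spread T []
spread (inside  ∷ T) (x ∷ w) = x ∷ spread T w

expand : Subset k → List (Fin 2) → Vec3 k
expand []            _       = []
expand (outside ∷ m) p       = zero ∷ expand m p
expand (inside  ∷ m) []      = zero ∷ expand m []
expand (inside  ∷ m) (x ∷ p) = suc x ∷ expand m p

spread-expand-word : (T : Subset n) (m : Subset k) (u : Vec3 n) →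
                     Supp u ≡ select T m → u ≡ spread T (expand m (word u))
spread-expand-word []            _             []          _  = refl
spread-expand-word (outside ∷ T) m             (zero  ∷ u) eq = cong (zero ∷_)  (spread-expand-word T m  u (∷-injectiveʳ eq))
spread-expand-word (inside  ∷ T) []            (zero  ∷ u) eq = cong (zero ∷_)  (spread-expand-word T [] u (∷-injectiveʳ eq))
spread-expand-word (inside  ∷ T) (outside ∷ m) (zero  ∷ u) eq = cong (zero ∷_)  (spread-expand-word T m  u (∷-injectiveʳ eq))
spread-expand-word (inside  ∷ T) (inside  ∷ m) (suc x ∷ u) eq = cong (suc x ∷_) (spread-expand-word T m  u (∷-injectiveʳ eq))
spread-expand-word (outside ∷ T) m             (suc _ ∷ _) ()
spread-expand-word (inside  ∷ T) []            (suc _ ∷ _) ()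
spread-expand-word (inside  ∷ T) (outside ∷ m) (suc _ ∷ _) ()
spread-expand-word (inside  ∷ T) (inside  ∷ m) (zero  ∷ _) ()

clashColumns-spread : (T : Subset n) {w₁ w₂ w₃ : Vec (Fin 3) k} →
                      ClashColumns w₁ w₂ w₃ → ClashColumns (spread T w₁) (spread T w₂) (spread T w₃)
clashColumns-spread []                                   _           = tt
clashColumns-spread (outside ∷ T)                        cols        = clash-000 , clashColumns-spread T cols
clashColumns-spread (inside ∷ T) {[]}    {[]}    {[]}    cols        = clash-000 , clashColumns-spread T cols
clashColumns-spread (inside ∷ T) {_ ∷ _} {_ ∷ _} {_ ∷ _} (col , cols) = col , clashColumns-spread T cols

data Pattern : Fin 4 → Fin 2 → List (Fin 2) → Set where
  pair₀       : ∀ {x} c d → Pattern zero x (x ∷ x ∷ c ∷ d ∷ [])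
  pair₁       : ∀ {x} a d → Pattern (suc zero) x (a ∷ x ∷ x ∷ d ∷ [])
  pair₂       : ∀ {x} a b → Pattern (suc (suc zero)) x (a ∷ b ∷ x ∷ x ∷ [])
  alternating : ∀ {x} → Pattern (suc (suc (suc zero))) x (x ∷ opposite x ∷ x ∷ opposite x ∷ [])

alternating-of : {a b c d : Fin 2} → a ≢ b → b ≢ c → c ≢ d →
                 Pattern (suc (suc (suc zero))) a (a ∷ b ∷ c ∷ d ∷ [])
alternating-of a≢b b≢c c≢d
  with refl ← ≢-≢⇒≡ a≢b b≢c | refl ← ≢-≢⇒≡ b≢c c≢d | refl ← ≢⇒≡opposite a≢b = alternating

classify : (p : List (Fin 2)) → length p ≡ 4 → Σ (Fin 4 × Fin 2) λ sx → uncurry Pattern sx p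
classify (a ∷ b ∷ c ∷ d ∷ []) _ with a ≟ b | b ≟ c | c ≟ d
... | yes refl | _        | _        = _ , pair₀ c d
... | no _     | yes refl | _        = _ , pair₁ a d
... | no _     | no _     | yes refl = _ , pair₂ a b
... | no a≢b   | no b≢c   | no c≢d   = _ , alternating-of a≢b b≢c c≢d

-- A word of shape s and letter x gets colour combine s x = 2s + x, so that exactly the
-- alternating words get the two colours of size 6 in ns556.
colour : (p : List (Fin 2)) → length p ≡ 4 → Fin 8
colour p h = uncurry combine (proj₁ (classify p h))

Fits : Fin 8 → List (Fin 2) → Set
Fits i = uncurry Pattern (remQuot 2 i)

fits-colour : (p : List (Fin 2)) (h : length p ≡ 4) → Fits (colour p h) p
fits-colour p h with classify p h
... | (s , x) , pat = subst (λ sx → uncurry Pattern sx p) (sym (remQuot-combine s x)) pat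

record ClashingMasks (k : ℕ) (P : List (Fin 2) → Set) : Set where
  field
    mask₁ mask₂ mask₃ : Subset k
    ∣mask₁∣≡4 : ∣ mask₁ ∣ ≡ 4
    ∣mask₂∣≡4 : ∣ mask₂ ∣ ≡ 4
    ∣mask₃∣≡4 : ∣ mask₃ ∣ ≡ 4
    mask₁≢mask₂ : mask₁ ≢ mask₂
    mask₂≢mask₃ : mask₂ ≢ mask₃
    mask₁≢mask₃ : mask₁ ≢ mask₃
    clash : ∀ {p₁ p₂ p₃} → P p₁ → P p₂ → P p₃ →
            ClashColumns (expand mask₁ p₁) (expand mask₂ p₂) (expand mask₃ p₃)

pair₀-masks : ∀ {x} → ClashingMasks 5 (Pattern zero x)
pair₀-masks {x} = record
  { mask₁ = ∁ ⁅ zero ⁆ ; mask₂ = ∁ ⁅ suc zero ⁆ ; mask₃ = ∁ ⁅ suc (suc zero) ⁆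
  ; ∣mask₁∣≡4 = refl ; ∣mask₂∣≡4 = refl ; ∣mask₃∣≡4 = refl
  ; mask₁≢mask₂ = λ () ; mask₂≢mask₃ = λ () ; mask₁≢mask₃ = λ ()
  ; clash = λ { (pair₀ c₁ d₁) (pair₀ c₂ d₂) (pair₀ c₃ d₃) →
      clash-0xx x , clash-x0x x , clash-xx0 x , clash-nonzero c₁ c₂ c₃ , clash-nonzero d₁ d₂ d₃ , tt }
  }

pair₁-masks : ∀ {x} → ClashingMasks 5 (Pattern (suc zero) x)
pair₁-masks {x} = record
  { mask₁ = ∁ ⁅ suc zero ⁆ ; mask₂ = ∁ ⁅ suc (suc zero) ⁆ ; mask₃ = ∁ ⁅ suc (suc (suc zero)) ⁆
  ; ∣mask₁∣≡4 = refl ; ∣mask₂∣≡4 = refl ; ∣mask₃∣≡4 = refl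
  ; mask₁≢mask₂ = λ () ; mask₂≢mask₃ = λ () ; mask₁≢mask₃ = λ ()
  ; clash = λ { (pair₁ a₁ d₁) (pair₁ a₂ d₂) (pair₁ a₃ d₃) →
      clash-nonzero a₁ a₂ a₃ , clash-0xx x , clash-x0x x , clash-xx0 x , clash-nonzero d₁ d₂ d₃ , tt }
  }

pair₂-masks : ∀ {x} → ClashingMasks 5 (Pattern (suc (suc zero)) x)
pair₂-masks {x} = record
  { mask₁ = ∁ ⁅ suc (suc zero) ⁆
  ; mask₂ = ∁ ⁅ suc (suc (suc zero)) ⁆
  ; mask₃ = ∁ ⁅ suc (suc (suc (suc zero))) ⁆
  ; ∣mask₁∣≡4 = refl ; ∣mask₂∣≡4 = refl ; ∣mask₃∣≡4 = refl
  ; mask₁≢mask₂ = λ () ; mask₂≢mask₃ = λ () ; mask₁≢mask₃ = λ ()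
  ; clash = λ { (pair₂ a₁ b₁) (pair₂ a₂ b₂) (pair₂ a₃ b₃) →
      clash-nonzero a₁ a₂ a₃ , clash-nonzero b₁ b₂ b₃ , clash-0xx x , clash-x0x x , clash-xx0 x , tt }
  }

alternating-masks : ∀ {x} → ClashingMasks 6 (Pattern (suc (suc (suc zero))) x)
alternating-masks {x} = record
  { mask₁ = inside  ∷ inside  ∷ inside  ∷ inside  ∷ outside ∷ outside ∷ []
  ; mask₂ = inside  ∷ inside  ∷ outside ∷ outside ∷ inside  ∷ inside  ∷ []
  ; mask₃ = outside ∷ outside ∷ inside  ∷ inside  ∷ inside  ∷ inside  ∷ []
  ; ∣mask₁∣≡4 = refl ; ∣mask₂∣≡4 = refl ; ∣mask₃∣≡4 = refl
  ; mask₁≢mask₂ = λ () ; mask₂≢mask₃ = λ () ; mask₁≢mask₃ = λ ()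
  ; clash = λ { alternating alternating alternating →
      clash-xx0 x , clash-xx0 (opposite x) , clash-x0x x , clash-x0x (opposite x) ,
      clash-0xx x , clash-0xx (opposite x) , tt }
  }

clashingMasks : (i : Fin 8) → ClashingMasks (ns556 i) (Fits i)
clashingMasks zero                                          = pair₀-masks
clashingMasks (suc zero)                                    = pair₀-masks
clashingMasks (suc (suc zero))                              = pair₁-masks
clashingMasks (suc (suc (suc zero)))                        = pair₁-masks
clashingMasks (suc (suc (suc (suc zero))))                  = pair₂-masks
clashingMasks (suc (suc (suc (suc (suc zero)))))            = pair₂-masks
clashingMasks (suc (suc (suc (suc (suc (suc zero))))))      = alternating-masks
clashingMasks (suc (suc (suc (suc (suc (suc (suc zero))))))) = alternating-masks

module _ {A : VecSet n} (admissible : Admissible A) where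

  clashingMasks-unrealisable :
    ∀ {P} (T : Subset n) → ∣ T ∣ ≡ k → (v : (m : Subset k) → ∣ m ∣ ≡ 4 → Vec3 n) →
    (∀ m h → A (v m h)) → (∀ m h → Supp (v m h) ≡ select T m) → (∀ m h → P (word (v m h))) →
    ¬ ClashingMasks k P
  clashingMasks-unrealisable T ∣T∣≡k v v∈A supp fits masks =
    proj₂ admissible (v _ _) (v _ _) (v _ _) (v∈A _ _) (v∈A _ _) (v∈A _ _)
      (distinct mask₁≢mask₂) (distinct mask₂≢mask₃) (distinct mask₁≢mask₃)
      (clash3 (spread-form mask₁ ∣mask₁∣≡4) (spread-form mask₂ ∣mask₂∣≡4) (spread-form mask₃ ∣mask₃∣≡4)
              (clash (fits _ _) (fits _ _) (fits _ _)))
    where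
    open ClashingMasks masks

    distinct : ∀ {m m′ h h′} → m ≢ m′ → v m h ≢ v m′ h′
    distinct m≢m′ eq =
      m≢m′ (select-injective T ∣T∣≡k (trans (sym (supp _ _)) (trans (cong Supp eq) (supp _ _))))

    spread-form : ∀ m h → v m h ≡ spread T (expand m (word (v m h)))
    spread-form m h = spread-expand-word T m (v m h) (supp m h)

    clash3 : ∀ {u₁ u₂ u₃ w₁ w₂ w₃} → u₁ ≡ spread T w₁ → u₂ ≡ spread T w₂ → u₃ ≡ spread T w₃ →
             ClashColumns w₁ w₂ w₃ → Clash3 {n} u₁ u₂ u₃
    clash3 refl refl refl = clashColumns⇒Clash3 ∘ clashColumns-spread T

module _ {R d : ℕ} {A : VecSet (R + d)} (isI : IsI (R + d) 4 A) where

  private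
    member : (S : Subset R) → ∣ S ∣ ≡ 4 → Σ (Vec3 (R + d)) λ v → A v × Supp v ≡ S ++ ⊥
    member S h = proj₁ (proj₂ isI) (S ++ ⊥) (trans (∣p++⊥∣ S) h)

    vector : (S : Subset R) → ∣ S ∣ ≡ 4 → Vec3 (R + d)
    vector S h = proj₁ (member S h)

    vector∈A : (S : Subset R) (h : ∣ S ∣ ≡ 4) → A (vector S h)
    vector∈A S h = proj₁ (proj₂ (member S h))

    Supp-vector : (S : Subset R) (h : ∣ S ∣ ≡ 4) → Supp (vector S h) ≡ S ++ ⊥
    Supp-vector S h = proj₂ (proj₂ (member S h))

    length-word-vector : (S : Subset R) (h : ∣ S ∣ ≡ 4) → length (word (vector S h)) ≡ 4
    length-word-vector S h = begin
      length (word (vector S h)) ≡⟨ length-word (vector S h) ⟩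
      ∣ Supp (vector S h) ∣      ≡⟨ cong ∣_∣ (Supp-vector S h) ⟩
      ∣ S ++ ⊥ ∣                 ≡⟨ ∣p++⊥∣ S ⟩
      ∣ S ∣                      ≡⟨ h ⟩
      4                          ∎
      where open ≡-Reasoning

  colouring : Colouring 4 R 8
  colouring S h = colour (word (vector S h)) (length-word-vector S h)

  monochromatic⇒¬admissible : ∀ {i T} → Monochromatic colouring i (ns556 i) T → ¬ Admissible A
  monochromatic⇒¬admissible {i} {T} (∣T∣≡nᵢ , mono) admissible =
    clashingMasks-unrealisable admissible (T ++ ⊥) (trans (∣p++⊥∣ T) ∣T∣≡nᵢ)
      v (λ m h → vector∈A _ _) Supp-v fits (clashingMasks i)
    where
    ∣select∣≡4 : (m : Subset (ns556 i)) → ∣ m ∣ ≡ 4 → ∣ select T m ∣ ≡ 4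
    ∣select∣≡4 m h = trans (∣select∣ T m ∣T∣≡nᵢ) h

    v : (m : Subset (ns556 i)) → ∣ m ∣ ≡ 4 → Vec3 (R + d)
    v m h = vector (select T m) (∣select∣≡4 m h)

    Supp-v : ∀ m h → Supp (v m h) ≡ select (T ++ ⊥) m
    Supp-v m h = trans (Supp-vector _ _) (sym (select-++-⊥ T m))

    fits : ∀ m h → Fits i (word (v m h))
    fits m h = subst (λ j → Fits j (word (v m h))) (mono (select T m) (∣select∣≡4 m h) (select-⊆ T m))
                 (fits-colour (word (v m h)) (length-word-vector (select T m) (∣select∣≡4 m h)))

corollary6 : (N R : ℕ) → IsRamseyNumber 4 8 ns556 R → R ≤ N →
                ¬ (Σ (VecSet N) λ A → IsI N 4 A × Admissible A)
corollary6 N R (ramsey , _) R≤N (A , isI , admissible) with m≤n⇒∃[o]m+o≡n R≤N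
... | d , refl with ramsey (colouring isI)
...   | _ , _ , monochromatic = monochromatic⇒¬admissible isI monochromatic admissible
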